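{- Let $\epsilon:A\otimes B\to 0$ be a dual pairing in a symmetric monoidal category, $(A,\mu_A)$ a semigroup, and $l,r:A\to B$ morphisms. Then $\lhd\circ(A\otimes r)=\rhd\circ(l\otimes A)$ (as maps $A\otimes A\to B$) if and only if $\epsilon\circ(\mu_A\otimes r)=\epsilon\circ(\mu_A\otimes l)\circ\sigma_{A\otimes A,A}$ (as maps $A\otimes A\otimes A\to 0$).
   Context: $\mathcal{V}$ is taken strict with symmetry $\sigma$; $0$ is a fixed object. A dual pairing is $\epsilon:A\otimes B\to 0$ such that for all $X$ the maps $\hom(X,B)\to\hom(A\otimes X,0)$, $f\mapsto\epsilon\circ(A\otimes f)$, and $\hom(X,A)\to\hom(X\otimes B,0)$, $g\mapsto\epsilon\circ(g\otimes B)$, are bijections. $\lhd:A\otimes B\to B$ is the unique map with $\epsilon\circ(A\otimes\lhd)=\epsilon\circ(\mu_A\otimes B)$, and $\rhd:B\otimes A\to B$ the unique map with $\epsilon\circ(A\otimes\rhd)=\epsilon\circ(\mu_A\otimes B)\circ\sigma_{A\otimes B,A}$. -}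

module Defs where

open import Level using (Level; _⊔_; suc)
open import Data.Product using (Σ; _×_)
open import Relation.Binary.Structures using (IsEquivalence)

-- A (not necessarily strict) symmetric monoidal category, with hom-setoids.
-- The paper works in a strict one ("V is taken strict"); by coherence every
-- symmetric monoidal category is equivalent to a strict one, and here the
-- identifications made by strictness are written out as explicit associators.
record SymMonCat (o ℓ e : Level) : Set (suc (o ⊔ ℓ ⊔ e)) where
  infixr 9 _∘_
  infix  4 _≈_
  infixr 10 _⊗₀_ _⊗₁_
  field
    Obj   : Set o
    _⇒_   : Obj → Obj → Set ℓ
    _≈_   : ∀ {A B} → A ⇒ B → A ⇒ B → Set e
    ≈-equiv : ∀ {A B} → IsEquivalence (_≈_ {A} {B})
    id    : ∀ {A} → A ⇒ A
    _∘_   : ∀ {A B C} → B ⇒ C → A ⇒ B → A ⇒ C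
    identityˡ : ∀ {A B} {f : A ⇒ B} → id ∘ f ≈ f
    identityʳ : ∀ {A B} {f : A ⇒ B} → f ∘ id ≈ f
    assoc : ∀ {A B C D} {f : A ⇒ B} {g : B ⇒ C} {h : C ⇒ D} →
            (h ∘ g) ∘ f ≈ h ∘ (g ∘ f)
    ∘-resp-≈ : ∀ {A B C} {f f' : B ⇒ C} {g g' : A ⇒ B} →
               f ≈ f' → g ≈ g' → f ∘ g ≈ f' ∘ g'
    _⊗₀_  : Obj → Obj → Obj
    _⊗₁_  : ∀ {A B C D} → A ⇒ B → C ⇒ D → (A ⊗₀ C) ⇒ (B ⊗₀ D)
    ⊗-id  : ∀ {A C} → id {A} ⊗₁ id {C} ≈ id
    ⊗-∘   : ∀ {A B C D E F} {f : A ⇒ B} {g : B ⇒ C} {h : D ⇒ E} {k : E ⇒ F} →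
            (g ∘ f) ⊗₁ (k ∘ h) ≈ (g ⊗₁ k) ∘ (f ⊗₁ h)
    ⊗-resp-≈ : ∀ {A B C D} {f f' : A ⇒ B} {g g' : C ⇒ D} →
               f ≈ f' → g ≈ g' → f ⊗₁ g ≈ f' ⊗₁ g'
    𝟙     : Obj
    λ⇒    : ∀ {A} → (𝟙 ⊗₀ A) ⇒ A
    λ⇐    : ∀ {A} → A ⇒ (𝟙 ⊗₀ A)
    ρ⇒    : ∀ {A} → (A ⊗₀ 𝟙) ⇒ A
    ρ⇐    : ∀ {A} → A ⇒ (A ⊗₀ 𝟙)
    λ-isoˡ : ∀ {A} → λ⇐ {A} ∘ λ⇒ ≈ id
    λ-isoʳ : ∀ {A} → λ⇒ {A} ∘ λ⇐ ≈ id
    ρ-isoˡ : ∀ {A} → ρ⇐ {A} ∘ ρ⇒ ≈ id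
    ρ-isoʳ : ∀ {A} → ρ⇒ {A} ∘ ρ⇐ ≈ id
    λ-natural : ∀ {A B} {f : A ⇒ B} → f ∘ λ⇒ ≈ λ⇒ ∘ (id ⊗₁ f)
    ρ-natural : ∀ {A B} {f : A ⇒ B} → f ∘ ρ⇒ ≈ ρ⇒ ∘ (f ⊗₁ id)
    α⇒    : ∀ {A B C} → ((A ⊗₀ B) ⊗₀ C) ⇒ (A ⊗₀ (B ⊗₀ C))
    α⇐    : ∀ {A B C} → (A ⊗₀ (B ⊗₀ C)) ⇒ ((A ⊗₀ B) ⊗₀ C)
    α-isoˡ : ∀ {A B C} → α⇐ {A} {B} {C} ∘ α⇒ ≈ id
    α-isoʳ : ∀ {A B C} → α⇒ {A} {B} {C} ∘ α⇐ ≈ id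
    α-natural : ∀ {A A' B B' C C'} {f : A ⇒ A'} {g : B ⇒ B'} {h : C ⇒ C'} →
                (f ⊗₁ (g ⊗₁ h)) ∘ α⇒ ≈ α⇒ ∘ ((f ⊗₁ g) ⊗₁ h)
    triangle : ∀ {A B} → (id {A} ⊗₁ λ⇒ {B}) ∘ α⇒ ≈ ρ⇒ ⊗₁ id
    pentagon : ∀ {A B C D} →
               (id {A} ⊗₁ α⇒ {B} {C} {D}) ∘ α⇒ {A} {B ⊗₀ C} {D} ∘ (α⇒ {A} {B} {C} ⊗₁ id {D})
                 ≈ α⇒ {A} {B} {C ⊗₀ D} ∘ α⇒ {A ⊗₀ B} {C} {D}
    σ     : ∀ {A B} → (A ⊗₀ B) ⇒ (B ⊗₀ A)
    σ-natural : ∀ {A A' B B'} {f : A ⇒ A'} {g : B ⇒ B'} →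
                (g ⊗₁ f) ∘ σ ≈ σ ∘ (f ⊗₁ g)
    σ-involutive : ∀ {A B} → σ {B} {A} ∘ σ {A} {B} ≈ id
    hexagon : ∀ {A B C} →
              α⇒ {B} {C} {A} ∘ σ {A} {B ⊗₀ C} ∘ α⇒ {A} {B} {C}
                ≈ (id {B} ⊗₁ σ {A} {C}) ∘ α⇒ {B} {A} {C} ∘ (σ {A} {B} ⊗₁ id {C})

module _ {o ℓ e} (𝒱 : SymMonCat o ℓ e) where
  open SymMonCat 𝒱

  IsHomBijection : ∀ {X Y Z W} → (X ⇒ Y → Z ⇒ W) → Set (ℓ ⊔ e)
  IsHomBijection F =
    (∀ f g → F f ≈ F g → f ≈ g) × (∀ h → Σ _ (λ f → F f ≈ h))

  IsDualPairing : (A B Zero : Obj) → (A ⊗₀ B) ⇒ Zero → Set (o ⊔ ℓ ⊔ e)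
  IsDualPairing A B Zero ε =
    (∀ X → IsHomBijection {X} {B} {A ⊗₀ X} {Zero} (λ f → ε ∘ (id ⊗₁ f))) ×
    (∀ X → IsHomBijection {X} {A} {X ⊗₀ B} {Zero} (λ g → ε ∘ (g ⊗₁ id)))

  IsSemigroup : (A : Obj) → (A ⊗₀ A) ⇒ A → Set e
  IsSemigroup A μ = μ ∘ (μ ⊗₁ id) ≈ μ ∘ (id ⊗₁ μ) ∘ α⇒

  IsLeftAction : ∀ {A B Zero} → (A ⊗₀ B) ⇒ Zero → (A ⊗₀ A) ⇒ A →
                 (A ⊗₀ B) ⇒ B → Set e
  IsLeftAction ε μ ◁ = ε ∘ (id ⊗₁ ◁) ∘ α⇒ ≈ ε ∘ (μ ⊗₁ id)

  IsRightAction : ∀ {A B Zero} → (A ⊗₀ B) ⇒ Zero → (A ⊗₀ A) ⇒ A →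
                  (B ⊗₀ A) ⇒ B → Set e
  IsRightAction {A} {B} ε μ ▷ =
    ε ∘ (id ⊗₁ ▷) ≈ ε ∘ (μ ⊗₁ id) ∘ α⇐ ∘ σ {A ⊗₀ B} {A} ∘ α⇐

{-# OPTIONS --safe #-}
-- Pair both maps A ⊗ A → B against A through ε.  The defining equations of ◁
-- and ▷ turn  ε ∘ (A ⊗ (◁ ∘ (A ⊗ r)))  into  ε ∘ (μ ⊗ r) ∘ α⇐  and
-- ε ∘ (A ⊗ (▷ ∘ (l ⊗ A)))  into  ε ∘ (μ ⊗ l) ∘ α⇐ ∘ σ ∘ α⇐.  So the equation
-- between the maps into B is equivalent to the equation between the pairings:
-- one way by cancelling the isomorphism α⇐, the other by injectivity of
-- f ↦ ε ∘ (A ⊗ f).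
module Submission where

open import Defs
open import Level using (Level)
open import Data.Product using (_×_; _,_; proj₁)
open import Relation.Binary.Bundles using (Setoid)
import Relation.Binary.Reasoning.Setoid as SetoidReasoning

module SymMonCatProperties {o ℓ e} (𝒱 : SymMonCat o ℓ e) where
  open SymMonCat 𝒱

  hom-setoid : Obj → Obj → Setoid ℓ e
  hom-setoid X Y = record { Carrier = X ⇒ Y ; _≈_ = _≈_ ; isEquivalence = ≈-equiv }

  module _ {X Y : Obj} where
    open Setoid (hom-setoid X Y) public using (refl; sym; trans)
    open SetoidReasoning (hom-setoid X Y) public

  ∘-resp-≈ˡ : ∀ {X Y Z} {f f' : Y ⇒ Z} {g : X ⇒ Y} → f ≈ f' → f ∘ g ≈ f' ∘ g
  ∘-resp-≈ˡ p = ∘-resp-≈ p refl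

  ∘-resp-≈ʳ : ∀ {X Y Z} {f : Y ⇒ Z} {g g' : X ⇒ Y} → g ≈ g' → f ∘ g ≈ f ∘ g'
  ∘-resp-≈ʳ p = ∘-resp-≈ refl p

  extendʳ : ∀ {V W X Y Z} {a : Y ⇒ Z} {b : X ⇒ Y} {c : W ⇒ Z} {d : X ⇒ W} {f : V ⇒ X} →
            a ∘ b ≈ c ∘ d → a ∘ (b ∘ f) ≈ c ∘ (d ∘ f)
  extendʳ {a = a} {b} {c} {d} {f} p = begin
    a ∘ (b ∘ f)   ≈⟨ sym assoc ⟩
    (a ∘ b) ∘ f   ≈⟨ ∘-resp-≈ˡ p ⟩
    (c ∘ d) ∘ f   ≈⟨ assoc ⟩
    c ∘ (d ∘ f)   ∎

  assoc⁴ : ∀ {U V W X Y Z} {f : Y ⇒ Z} {g : X ⇒ Y} {h : W ⇒ X} {k : V ⇒ W} {m : U ⇒ V} →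
           (f ∘ g ∘ h ∘ k) ∘ m ≈ f ∘ g ∘ h ∘ k ∘ m
  assoc⁴ = trans assoc (∘-resp-≈ʳ (trans assoc (∘-resp-≈ʳ assoc)))

  assoc⁵ : ∀ {T U V W X Y Z} {f : Y ⇒ Z} {g : X ⇒ Y} {h : W ⇒ X} {k : V ⇒ W} {m : U ⇒ V}
             {n : T ⇒ U} → (f ∘ g ∘ h ∘ k ∘ m) ∘ n ≈ f ∘ g ∘ h ∘ k ∘ m ∘ n
  assoc⁵ = trans assoc (∘-resp-≈ʳ assoc⁴)

  cancel-α⇐ʳ : ∀ {X Y Z W} {f g : ((X ⊗₀ Y) ⊗₀ Z) ⇒ W} → f ∘ α⇐ ≈ g ∘ α⇐ → f ≈ g
  cancel-α⇐ʳ {f = f} {g} p = begin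
    f                ≈⟨ sym identityʳ ⟩
    f ∘ id           ≈⟨ ∘-resp-≈ʳ (sym α-isoˡ) ⟩
    f ∘ (α⇐ ∘ α⇒)    ≈⟨ sym assoc ⟩
    (f ∘ α⇐) ∘ α⇒    ≈⟨ ∘-resp-≈ˡ p ⟩
    (g ∘ α⇐) ∘ α⇒    ≈⟨ assoc ⟩
    g ∘ (α⇐ ∘ α⇒)    ≈⟨ ∘-resp-≈ʳ α-isoˡ ⟩
    g ∘ id           ≈⟨ identityʳ ⟩
    g                ∎

  α⇐-natural : ∀ {X X' Y Y' Z Z'} {f : X ⇒ X'} {g : Y ⇒ Y'} {h : Z ⇒ Z'} →
               α⇐ ∘ (f ⊗₁ (g ⊗₁ h)) ≈ ((f ⊗₁ g) ⊗₁ h) ∘ α⇐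
  α⇐-natural {f = f} {g} {h} = begin
    α⇐ ∘ (f ⊗₁ (g ⊗₁ h))                 ≈⟨ sym identityʳ ⟩
    (α⇐ ∘ (f ⊗₁ (g ⊗₁ h))) ∘ id          ≈⟨ ∘-resp-≈ʳ (sym α-isoʳ) ⟩
    (α⇐ ∘ (f ⊗₁ (g ⊗₁ h))) ∘ (α⇒ ∘ α⇐)   ≈⟨ assoc ⟩
    α⇐ ∘ (f ⊗₁ (g ⊗₁ h)) ∘ α⇒ ∘ α⇐       ≈⟨ ∘-resp-≈ʳ (extendʳ α-natural) ⟩
    α⇐ ∘ α⇒ ∘ ((f ⊗₁ g) ⊗₁ h) ∘ α⇐       ≈⟨ sym assoc ⟩
    (α⇐ ∘ α⇒) ∘ ((f ⊗₁ g) ⊗₁ h) ∘ α⇐     ≈⟨ ∘-resp-≈ˡ α-isoˡ ⟩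
    id ∘ ((f ⊗₁ g) ⊗₁ h) ∘ α⇐            ≈⟨ identityˡ ⟩
    ((f ⊗₁ g) ⊗₁ h) ∘ α⇐                 ∎

  id⊗-∘ : ∀ {W X Y Z} {f : Y ⇒ Z} {g : X ⇒ Y} → id {W} ⊗₁ (f ∘ g) ≈ (id ⊗₁ f) ∘ (id ⊗₁ g)
  id⊗-∘ = trans (⊗-resp-≈ (sym identityˡ) refl) ⊗-∘

  serialize : ∀ {W X X' Y Y'} {f : (W ⊗₀ X) ⇒ X'} {g : Y ⇒ Y'} →
              (f ⊗₁ id) ∘ ((id ⊗₁ id) ⊗₁ g) ≈ f ⊗₁ g
  serialize = trans (∘-resp-≈ʳ (⊗-resp-≈ ⊗-id refl))
                    (trans (sym ⊗-∘) (⊗-resp-≈ identityʳ identityˡ))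

  module _ {A B Zero : Obj} (ε : (A ⊗₀ B) ⇒ Zero) (μ : (A ⊗₀ A) ⇒ A) where

    left-action-α⇐ : ∀ {◁ : (A ⊗₀ B) ⇒ B} → IsLeftAction 𝒱 ε μ ◁ →
                     ε ∘ (id ⊗₁ ◁) ≈ ε ∘ (μ ⊗₁ id) ∘ α⇐
    left-action-α⇐ {◁} left = begin
      ε ∘ (id ⊗₁ ◁)                 ≈⟨ sym identityʳ ⟩
      (ε ∘ (id ⊗₁ ◁)) ∘ id          ≈⟨ ∘-resp-≈ʳ (sym α-isoʳ) ⟩
      (ε ∘ (id ⊗₁ ◁)) ∘ α⇒ ∘ α⇐     ≈⟨ sym assoc ⟩
      ((ε ∘ (id ⊗₁ ◁)) ∘ α⇒) ∘ α⇐   ≈⟨ ∘-resp-≈ˡ (trans assoc left) ⟩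
      (ε ∘ (μ ⊗₁ id)) ∘ α⇐          ≈⟨ assoc ⟩
      ε ∘ (μ ⊗₁ id) ∘ α⇐            ∎

    pairing-◁∘id⊗ : ∀ {◁ : (A ⊗₀ B) ⇒ B} → IsLeftAction 𝒱 ε μ ◁ →
                    ∀ {X} (r : X ⇒ B) →
                    ε ∘ (id ⊗₁ (◁ ∘ (id ⊗₁ r))) ≈ (ε ∘ (μ ⊗₁ r)) ∘ α⇐
    pairing-◁∘id⊗ {◁} left r = begin
      ε ∘ (id ⊗₁ (◁ ∘ (id ⊗₁ r)))              ≈⟨ ∘-resp-≈ʳ id⊗-∘ ⟩
      ε ∘ (id ⊗₁ ◁) ∘ (id ⊗₁ (id ⊗₁ r))        ≈⟨ sym assoc ⟩
      (ε ∘ (id ⊗₁ ◁)) ∘ (id ⊗₁ (id ⊗₁ r))      ≈⟨ ∘-resp-≈ˡ (left-action-α⇐ left) ⟩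
      (ε ∘ (μ ⊗₁ id) ∘ α⇐) ∘ (id ⊗₁ (id ⊗₁ r)) ≈⟨ trans assoc (∘-resp-≈ʳ assoc) ⟩
      ε ∘ (μ ⊗₁ id) ∘ α⇐ ∘ (id ⊗₁ (id ⊗₁ r))   ≈⟨ ∘-resp-≈ʳ (∘-resp-≈ʳ α⇐-natural) ⟩
      ε ∘ (μ ⊗₁ id) ∘ ((id ⊗₁ id) ⊗₁ r) ∘ α⇐   ≈⟨ ∘-resp-≈ʳ (trans (sym assoc) (∘-resp-≈ˡ serialize)) ⟩
      ε ∘ (μ ⊗₁ r) ∘ α⇐                        ≈⟨ sym assoc ⟩
      (ε ∘ (μ ⊗₁ r)) ∘ α⇐                      ∎

    pairing-▷∘⊗id : ∀ {▷ : (B ⊗₀ A) ⇒ B} → IsRightAction 𝒱 ε μ ▷ →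
                    ∀ {X} (l : X ⇒ B) →
                    ε ∘ (id ⊗₁ (▷ ∘ (l ⊗₁ id))) ≈ (ε ∘ (μ ⊗₁ l) ∘ α⇐ ∘ σ {A ⊗₀ X} {A}) ∘ α⇐
    pairing-▷∘⊗id {▷} right l = begin
      ε ∘ (id ⊗₁ (▷ ∘ (l ⊗₁ id)))                        ≈⟨ ∘-resp-≈ʳ id⊗-∘ ⟩
      ε ∘ (id ⊗₁ ▷) ∘ (id ⊗₁ (l ⊗₁ id))                  ≈⟨ sym assoc ⟩
      (ε ∘ (id ⊗₁ ▷)) ∘ (id ⊗₁ (l ⊗₁ id))                ≈⟨ ∘-resp-≈ˡ right ⟩
      (ε ∘ (μ ⊗₁ id) ∘ α⇐ ∘ σ ∘ α⇐) ∘ (id ⊗₁ (l ⊗₁ id))  ≈⟨ assoc⁵ ⟩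
      ε ∘ (μ ⊗₁ id) ∘ α⇐ ∘ σ ∘ α⇐ ∘ (id ⊗₁ (l ⊗₁ id))    ≈⟨ ∘-resp-≈ʳ (∘-resp-≈ʳ (∘-resp-≈ʳ (∘-resp-≈ʳ α⇐-natural))) ⟩
      ε ∘ (μ ⊗₁ id) ∘ α⇐ ∘ σ ∘ ((id ⊗₁ l) ⊗₁ id) ∘ α⇐    ≈⟨ ∘-resp-≈ʳ (∘-resp-≈ʳ (∘-resp-≈ʳ (extendʳ (sym σ-natural)))) ⟩
      ε ∘ (μ ⊗₁ id) ∘ α⇐ ∘ (id ⊗₁ (id ⊗₁ l)) ∘ σ ∘ α⇐    ≈⟨ ∘-resp-≈ʳ (∘-resp-≈ʳ (extendʳ α⇐-natural)) ⟩
      ε ∘ (μ ⊗₁ id) ∘ ((id ⊗₁ id) ⊗₁ l) ∘ α⇐ ∘ σ ∘ α⇐    ≈⟨ ∘-resp-≈ʳ (trans (sym assoc) (∘-resp-≈ˡ serialize)) ⟩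
      ε ∘ (μ ⊗₁ l) ∘ α⇐ ∘ σ ∘ α⇐                         ≈⟨ sym assoc⁴ ⟩
      (ε ∘ (μ ⊗₁ l) ∘ α⇐ ∘ σ) ∘ α⇐                       ∎

mainTheorem14 : ∀ {o ℓ e : Level} (𝒱 : SymMonCat o ℓ e) →
    let open SymMonCat 𝒱 in
    (A B Zero : Obj) (ε : (A ⊗₀ B) ⇒ Zero) → IsDualPairing 𝒱 A B Zero ε →
    (μ : (A ⊗₀ A) ⇒ A) → IsSemigroup 𝒱 A μ →
    (◁ : (A ⊗₀ B) ⇒ B) → IsLeftAction 𝒱 ε μ ◁ →
    (▷ : (B ⊗₀ A) ⇒ B) → IsRightAction 𝒱 ε μ ▷ →
    (l r : A ⇒ B) →
    ((◁ ∘ (id ⊗₁ r) ≈ ▷ ∘ (l ⊗₁ id) →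
        ε ∘ (μ ⊗₁ r) ≈ ε ∘ (μ ⊗₁ l) ∘ α⇐ ∘ σ {A ⊗₀ A} {A})
     × (ε ∘ (μ ⊗₁ r) ≈ ε ∘ (μ ⊗₁ l) ∘ α⇐ ∘ σ {A ⊗₀ A} {A} →
        ◁ ∘ (id ⊗₁ r) ≈ ▷ ∘ (l ⊗₁ id)))
mainTheorem14 𝒱 A B Zero ε pairing μ _ ◁ left ▷ right l r = to , from
  where
  open SymMonCat 𝒱
  open SymMonCatProperties 𝒱

  ◁-side : ε ∘ (id ⊗₁ (◁ ∘ (id ⊗₁ r))) ≈ (ε ∘ (μ ⊗₁ r)) ∘ α⇐
  ◁-side = pairing-◁∘id⊗ ε μ left r

  ▷-side : ε ∘ (id ⊗₁ (▷ ∘ (l ⊗₁ id))) ≈ (ε ∘ (μ ⊗₁ l) ∘ α⇐ ∘ σ) ∘ α⇐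
  ▷-side = pairing-▷∘⊗id ε μ right l

  pairing-injective : ∀ {f g : (A ⊗₀ A) ⇒ B} → ε ∘ (id ⊗₁ f) ≈ ε ∘ (id ⊗₁ g) → f ≈ g
  pairing-injective = proj₁ (proj₁ pairing (A ⊗₀ A)) _ _

  to : ◁ ∘ (id ⊗₁ r) ≈ ▷ ∘ (l ⊗₁ id) → ε ∘ (μ ⊗₁ r) ≈ ε ∘ (μ ⊗₁ l) ∘ α⇐ ∘ σ
  to maps≈ = cancel-α⇐ʳ (begin
    (ε ∘ (μ ⊗₁ r)) ∘ α⇐            ≈⟨ sym ◁-side ⟩
    ε ∘ (id ⊗₁ (◁ ∘ (id ⊗₁ r)))    ≈⟨ ∘-resp-≈ʳ (⊗-resp-≈ refl maps≈) ⟩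
    ε ∘ (id ⊗₁ (▷ ∘ (l ⊗₁ id)))    ≈⟨ ▷-side ⟩
    (ε ∘ (μ ⊗₁ l) ∘ α⇐ ∘ σ) ∘ α⇐   ∎)

  from : ε ∘ (μ ⊗₁ r) ≈ ε ∘ (μ ⊗₁ l) ∘ α⇐ ∘ σ → ◁ ∘ (id ⊗₁ r) ≈ ▷ ∘ (l ⊗₁ id)
  from pairings≈ = pairing-injective (begin
    ε ∘ (id ⊗₁ (◁ ∘ (id ⊗₁ r)))    ≈⟨ ◁-side ⟩
    (ε ∘ (μ ⊗₁ r)) ∘ α⇐            ≈⟨ ∘-resp-≈ˡ pairings≈ ⟩
    (ε ∘ (μ ⊗₁ l) ∘ α⇐ ∘ σ) ∘ α⇐   ≈⟨ sym ▷-side ⟩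
    ε ∘ (id ⊗₁ (▷ ∘ (l ⊗₁ id)))    ∎)
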